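{- Let $\mathcal B,\mathcal B^*$ be matroids on a finite set $X$ and $B\mapsto B^*$ a linking $\mathcal B\to\mathcal B^*$; let $\omega,\pi,a,z,\varepsilon$ be as in the context. Let $B\in\mathcal B$. If either $B$ is a branching image in $\mathcal B$ or $B^*$ is a branching image in $\mathcal B^*$, then $\varepsilon$ induces a bijection $\varphi_\omega^{ -1}(B)\to\varphi_\pi^{ -1}(\varepsilon(B))$ (preimages taken among almost-bases of $\mathcal B$).
   Context: A pre-matroid on a finite set $X$ is a non-empty set of subsets of $X$ (bases). For $Y\subseteq X$, $x\notin Y$, $Y+x=Y\cup\{x\}$; for $y\in Y$, $Y-y=Y\setminus\{y\}$. An almost-basis of a pre-matroid $\mathcal C$ is $B-x$ with $B\in\mathcal C$, $x\in B$; $U(D)=\{x\notin D: D+x\in\mathcal C\}$. A matroid is a pre-matroid such that for all bases $B_1,B_2$ and $x\in B_1\setminus B_2$ there is $y\in B_2\setminus B_1$ with $B_1-x+y$ a basis. A transposition exchanges two distinct elements of $X$ and fixes the rest; it acts on subsets elementwise. A bijection $\mathcal B\to\mathcal B^*$, $B\mapsto B^*$, is a linking if for all $B\in\mathcal B$ and transpositions $\tau$: (L1) if $\tau(B)\in\mathcal B$ then $\tau(B^*)\in\mathcal B^*$ and $\tau(B^*)=\tau(B)^*$; (L2) if $\tau(B^*)\in\mathcal B^*$ then $\tau(B)\in\mathcal B$ and $\tau(B^*)=\tau(B)^*$. For a linear order $\rho$ and an almost-basis $D$ of a pre-matroid, $\varphi_\rho(D)=D+\min_\rho U(D)$ (computed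 in that pre-matroid). Let $\omega$ be a linear order on $X$, $a\ne z$ consecutive for $\omega$ with $a<_\omega z$, $\varepsilon$ the transposition of $a,z$, and $\pi$ the linear order agreeing with $\omega$ except $z<_\pi a$. An almost-basis $D$ is branching if $\varphi_\omega(D)\ne\varphi_\pi(D)$. A basis is a branching image if it equals $\varphi_\omega(A)$ or $\varphi_\pi(A)$ for some branching almost-basis $A$ of the same pre-matroid. -}

module Defs where

open import Data.Nat using (ℕ; suc)
open import Data.Bool using (Bool; true; false; not; _∧_; T)
open import Data.Fin using (Fin; toℕ)
open import Data.Fin.Subset using (Subset; inside; outside; _∈_; _∉_)
open import Data.Fin.Permutation using (Permutation′; _⟨$⟩ʳ_; _⟨$⟩ˡ_; _∘ₚ_; transpose)
import Data.Fin.Permutation.Components as PC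
open import Data.Vec using (Vec; lookup; tabulate; _[_]≔_)
open import Data.List using (List; map; allFin; findᵇ)
open import Data.Maybe using (Maybe; just; nothing)
import Data.Maybe as Maybe
open import Data.Product using (Σ; ∃; ∃-syntax; _×_; _,_; proj₁)
open import Data.Sum using (_⊎_)
open import Function using (_∘_)
open import Function.Bundles using (_⤖_; Bijection)
open import Relation.Binary.PropositionalEquality using (_≡_; _≢_)

-- The ground set X is Fin n; subsets of X are Data.Fin.Subset n.
-- A family of subsets of X (a candidate set of bases), given by its
-- (decidable) membership test.
Family : ℕ → Set
Family n = Subset n → Bool

module _ {n : ℕ} where

  _+ₛ_ : Subset n → Fin n → Subset n
  Y +ₛ x = Y [ x ]≔ inside

  _-ₛ_ : Subset n → Fin n → Subset n
  Y -ₛ y = Y [ y ]≔ outside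

  -- the transposition exchanging i and j, acting elementwise on subsets:
  -- τ(Y) = { τ x | x ∈ Y }, i.e. x ∈ τ(Y) iff τ x ∈ Y (τ is an involution)
  swapS : Fin n → Fin n → Subset n → Subset n
  swapS i j Y = tabulate (λ x → lookup Y (PC.transpose i j x))

  IsPreMatroid : Family n → Set
  IsPreMatroid 𝓒 = ∃[ B ] T (𝓒 B)

  IsMatroid : Family n → Set
  IsMatroid 𝓒 = IsPreMatroid 𝓒 ×
    (∀ B₁ B₂ → T (𝓒 B₁) → T (𝓒 B₂) → ∀ x → x ∈ B₁ → x ∉ B₂ →
       ∃[ y ] (y ∈ B₂ × y ∉ B₁ × T (𝓒 ((B₁ -ₛ x) +ₛ y))))

  AlmostBasis : Family n → Subset n → Set
  AlmostBasis 𝓒 D = ∃[ B ] ∃[ x ] (T (𝓒 B) × x ∈ B × D ≡ B -ₛ x)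

  U : Family n → Subset n → Fin n → Bool
  U 𝓒 D x = not (lookup D x) ∧ 𝓒 (D +ₛ x)

  -- A linear order ρ on X is given by a ranking bijection ρ : X ≅ Fin n,
  -- x <ρ y  iff  toℕ (ρ x) < toℕ (ρ y).
  LinOrder : Set
  LinOrder = Permutation′ n

  rank : LinOrder → Fin n → ℕ
  rank ρ x = toℕ (ρ ⟨$⟩ʳ x)

  ordered : LinOrder → List (Fin n)
  ordered ρ = map (ρ ⟨$⟩ˡ_) (allFin n)

  minBy : LinOrder → (Fin n → Bool) → Maybe (Fin n)
  minBy ρ S = findᵇ S (ordered ρ)

  -- φ_ρ(D) = D + min_ρ U(D)   (defined, i.e. `just`, whenever U(D) ≠ ∅,
  -- in particular for every almost-basis)
  φ : Family n → LinOrder → Subset n → Maybe (Subset n)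
  φ 𝓒 ρ D = Maybe.map (D +ₛ_) (minBy ρ (U 𝓒 D))

  -- π: agrees with ω except that z <π a, where a,z are ω-consecutive;
  -- rank_π(x) = rank_ω(ε x)
  swapOrder : LinOrder → Fin n → Fin n → LinOrder
  swapOrder ω a z = transpose a z ∘ₚ ω

  Branching : Family n → LinOrder → LinOrder → Subset n → Set
  Branching 𝓒 ω π D = AlmostBasis 𝓒 D × (φ 𝓒 ω D ≢ φ 𝓒 π D)

  BranchingImage : Family n → LinOrder → LinOrder → Subset n → Set
  BranchingImage 𝓒 ω π B =
    ∃[ A ] (Branching 𝓒 ω π A × (φ 𝓒 ω A ≡ just B ⊎ φ 𝓒 π A ≡ just B))

  Bases : Family n → Set
  Bases 𝓒 = Σ (Subset n) (T ∘ 𝓒)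

  record Linking (𝓑 𝓑* : Family n) : Set where
    field
      bij : Bases 𝓑 ⤖ Bases 𝓑*
    star : (B : Subset n) → T (𝓑 B) → Subset n
    star B b = proj₁ (Bijection.to bij (B , b))
    field
      L1 : ∀ B (b : T (𝓑 B)) (i j : Fin n) → i ≢ j →
             (tb : T (𝓑 (swapS i j B))) →
             T (𝓑* (swapS i j (star B b))) × swapS i j (star B b) ≡ star (swapS i j B) tb
      L2 : ∀ B (b : T (𝓑 B)) (i j : Fin n) → i ≢ j →
             T (𝓑* (swapS i j (star B b))) →
             Σ (T (𝓑 (swapS i j B))) λ tb → swapS i j (star B b) ≡ star (swapS i j B) tb

module Submission where

-- Write ε for the transposition of a and z, so that π = ω ∘ ε.  If x is the ω-least element
-- for which D + x is a basis, then the π-least y for which εD + y is a basis is ε of the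
-- ω-least y for which ε(D + y) is a basis; so it suffices that x is least for this twisted
-- family too.  If x ∈ {a, z}, then D is ε-invariant and both a and z extend D.  Otherwise D
-- contains exactly one element c of {a, z}, with partner c', and a w <ω x for which ε(D + w)
-- is a basis yields, by two basis exchanges between B = D + x and ε(D + w), bases B - c + w
-- and B - x + c' with w, x <ω a, while B - x + w = D + w is not a basis.  This configuration
-- is excluded for B and εB by the hypothesis: a branching almost-basis A has a as its ω-least
-- and z as its π-least extension, so nothing below a extends A, and when B* = A + c the
-- linking axioms carry the configuration over to such an extension of A.  The inverse map is
-- the same argument for π, in which z, a are consecutive.

open import Defs
open import Data.Nat using (ℕ; suc; _≤_; _<_; z≤n; s≤s)
open import Data.Nat.Properties
  using (<-irrefl; <-trans; ≮⇒≥; ≤-antisym; ≤∧≢⇒<; ≤-pred; n≤1+n; n<1+n; <⇒≱; ≤-refl; ≤-trans)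
open import Data.Bool using (Bool; true; false; not; _∧_; T)
open import Data.Bool.Properties using (T-irrelevant; not-¬)
open import Data.Empty using (⊥; ⊥-elim)
open import Data.Fin as Fin using (Fin; toℕ; _≟_)
open import Data.Fin.Properties using (toℕ-injective)
open import Data.Fin.Subset using (Subset; _∉_)
open import Data.Fin.Permutation using (_⟨$⟩ʳ_; _⟨$⟩ˡ_; inverseˡ; inverseʳ)
import Data.Fin.Permutation.Components as PC
open import Data.List as List using (findᵇ)
open import Data.List.Properties using (map-tabulate)
open import Data.Maybe using (just; nothing)
open import Data.Maybe.Properties using (just-injective)
open import Data.Product using (Σ; ∃-syntax; _×_; _,_; proj₁; proj₂; map₂)
open import Function.Bundles using (Bijection)
open import Function.Construct.Identity using (⤖-id)
open import Data.Sum using (_⊎_; inj₁; inj₂; [_,_]′)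
open import Data.Vec using (lookup; _[_]≔_)
open import Data.Vec.Properties
  using (lookup∘update; lookup∘update′; lookup∘tabulate; tabulate∘lookup; tabulate-cong;
         []≔-idempotent; []≔-lookup; []≔-commutes; lookup⇒[]=; []=⇒lookup)
open import Function using (_∘_; id)
open import Relation.Nullary using (¬_; yes; no)
open import Relation.Nullary.Decidable using (dec-true; dec-false)
open import Relation.Binary.PropositionalEquality
  using (_≡_; _≢_; refl; sym; trans; cong; cong₂; subst; subst₂; module ≡-Reasoning)
open ≡-Reasoning

U⇒∉ : ∀ {b c} → T (not b ∧ c) → b ≡ false
U⇒∉ {false} _ = refl

U⇒basis : ∀ {b c} → T (not b ∧ c) → T c
U⇒basis {false} u = u

U-intro : ∀ {b c} → b ≡ false → T c → T (not b ∧ c)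
U-intro refl u = u

-- Subsets and transpositions

module _ {n : ℕ} where

  subset-ext : {X Y : Subset n} → (∀ i → lookup X i ≡ lookup Y i) → X ≡ Y
  subset-ext {X} {Y} eq =
    trans (sym (tabulate∘lookup X)) (trans (tabulate-cong eq) (tabulate∘lookup Y))

  lookup-+ₛ-same : ∀ (Y : Subset n) x → lookup (Y +ₛ x) x ≡ true
  lookup-+ₛ-same Y x = lookup∘update x Y true

  lookup-+ₛ : ∀ (Y : Subset n) {x i} → i ≢ x → lookup (Y +ₛ x) i ≡ lookup Y i
  lookup-+ₛ Y i≢x = lookup∘update′ i≢x Y true

  lookup--ₛ-same : ∀ (Y : Subset n) x → lookup (Y -ₛ x) x ≡ false
  lookup--ₛ-same Y x = lookup∘update x Y false

  lookup--ₛ : ∀ (Y : Subset n) {x i} → i ≢ x → lookup (Y -ₛ x) i ≡ lookup Y i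
  lookup--ₛ Y i≢x = lookup∘update′ i≢x Y false

  +ₛ-mono : ∀ (Y : Subset n) x {i} → lookup Y i ≡ true → lookup (Y +ₛ x) i ≡ true
  +ₛ-mono Y x {i} i∈Y with i ≟ x
  ... | yes refl = lookup-+ₛ-same Y x
  ... | no i≢x   = trans (lookup-+ₛ Y i≢x) i∈Y

  ∉-+ₛ : ∀ (Y : Subset n) x {i} → lookup (Y +ₛ x) i ≡ false → lookup Y i ≡ false
  ∉-+ₛ Y x {i} i∉Y+x with i ≟ x
  ... | yes refl = ⊥-elim (not-¬ (lookup-+ₛ-same Y x) i∉Y+x)
  ... | no i≢x   = trans (sym (lookup-+ₛ Y i≢x)) i∉Y+x

  +ₛ--ₛ : ∀ {Y : Subset n} {x} → lookup Y x ≡ false → (Y +ₛ x) -ₛ x ≡ Y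
  +ₛ--ₛ {Y} {x} x∉Y =
    trans ([]≔-idempotent Y x) (trans (cong (Y [ x ]≔_) (sym x∉Y)) ([]≔-lookup Y x))

  -ₛ-+ₛ : ∀ {Y : Subset n} {x} → lookup Y x ≡ true → (Y -ₛ x) +ₛ x ≡ Y
  -ₛ-+ₛ {Y} {x} x∈Y =
    trans ([]≔-idempotent Y x) (trans (cong (Y [ x ]≔_) (sym x∈Y)) ([]≔-lookup Y x))

  transpose-matchˡ : ∀ (i j : Fin n) → PC.transpose i j i ≡ j
  transpose-matchˡ i j rewrite dec-true (i ≟ i) refl = refl

  transpose-matchʳ : ∀ (i j : Fin n) → PC.transpose i j j ≡ i
  transpose-matchʳ i j with j ≟ i
  ... | yes j≡i = j≡i
  ... | no _ rewrite dec-true (j ≟ j) refl = refl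

  transpose-other : ∀ {i j k : Fin n} → k ≢ i → k ≢ j → PC.transpose i j k ≡ k
  transpose-other {i} {j} {k} k≢i k≢j
    rewrite dec-false (k ≟ i) k≢i | dec-false (k ≟ j) k≢j = refl

  data Which (i j : Fin n) : Fin n → Set where
    first  : Which i j i
    second : Which i j j
    other  : ∀ {k} → k ≢ i → k ≢ j → Which i j k

  which : ∀ i j k → Which i j k
  which i j k with k ≟ i | k ≟ j
  ... | yes refl | _        = first
  ... | no _     | yes refl = second
  ... | no k≢i   | no k≢j   = other k≢i k≢j

  transpose-comm : ∀ (i j k : Fin n) → PC.transpose i j k ≡ PC.transpose j i k
  transpose-comm i j k with which i j k
  ... | first       = trans (transpose-matchˡ k j) (sym (transpose-matchʳ j k))
  ... | second      = trans (transpose-matchʳ i k) (sym (transpose-matchˡ k i))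
  ... | other k≢i k≢j = trans (transpose-other k≢i k≢j) (sym (transpose-other k≢j k≢i))

  transpose-involutive : ∀ (i j k : Fin n) → PC.transpose i j (PC.transpose i j k) ≡ k
  transpose-involutive i j k =
    trans (cong (PC.transpose i j) (transpose-comm i j k)) (PC.transpose-inverse i j)

  lookup-swapS : ∀ (i j : Fin n) Y k → lookup (swapS i j Y) k ≡ lookup Y (PC.transpose i j k)
  lookup-swapS i j Y = lookup∘tabulate (lookup Y ∘ PC.transpose i j)

  swapS-comm : ∀ (i j : Fin n) Y → swapS i j Y ≡ swapS j i Y
  swapS-comm i j Y = tabulate-cong (cong (lookup Y) ∘ transpose-comm i j)

  swapS-involutive : ∀ (i j : Fin n) Y → swapS i j (swapS i j Y) ≡ Y
  swapS-involutive i j Y = subset-ext λ k →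
    trans (lookup-swapS i j (swapS i j Y) k)
      (trans (lookup-swapS i j Y (PC.transpose i j k)) (cong (lookup Y) (transpose-involutive i j k)))

  swapS-fixed : ∀ {i j : Fin n} {Y} → lookup Y i ≡ lookup Y j → swapS i j Y ≡ Y
  swapS-fixed {i} {j} {Y} eq = subset-ext λ k → trans (lookup-swapS i j Y k) (fixes k)
    where
    fixes : ∀ k → lookup Y (PC.transpose i j k) ≡ lookup Y k
    fixes k with which i j k
    ... | first         = trans (cong (lookup Y) (transpose-matchˡ k j)) (sym eq)
    ... | second        = trans (cong (lookup Y) (transpose-matchʳ i k)) eq
    ... | other k≢i k≢j = cong (lookup Y) (transpose-other k≢i k≢j)

  swapS-fixed⁻¹ : ∀ {i j : Fin n} {Y} → swapS i j Y ≡ Y → lookup Y i ≡ lookup Y j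
  swapS-fixed⁻¹ {i} {j} {Y} eq =
    trans (cong (λ X → lookup X i) (sym eq))
          (trans (lookup-swapS i j Y i) (cong (lookup Y) (transpose-matchˡ i j)))

  swapS-+ₛ : ∀ (i j : Fin n) Y x → swapS i j (Y +ₛ x) ≡ swapS i j Y +ₛ PC.transpose i j x
  swapS-+ₛ i j Y x = subset-ext λ k →
    trans (lookup-swapS i j (Y +ₛ x) k) (pointwise k)
    where
    τ = PC.transpose i j
    pointwise : ∀ k → lookup (Y +ₛ x) (τ k) ≡ lookup (swapS i j Y +ₛ τ x) k
    pointwise k with k ≟ τ x
    ... | yes refl = trans (cong (lookup (Y +ₛ x)) (transpose-involutive i j x))
                       (trans (lookup-+ₛ-same Y x) (sym (lookup-+ₛ-same (swapS i j Y) (τ x))))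
    ... | no k≢τx = trans (lookup-+ₛ Y τk≢x)
                      (sym (trans (lookup-+ₛ (swapS i j Y) k≢τx) (lookup-swapS i j Y k)))
      where
      τk≢x : τ k ≢ x
      τk≢x τk≡x = k≢τx (trans (sym (transpose-involutive i j k)) (cong τ τk≡x))

  swapS-exchange : ∀ {B : Subset n} {i j} → lookup B i ≡ true → lookup B j ≡ false →
                   swapS i j B ≡ (B -ₛ i) +ₛ j
  swapS-exchange {B} {i} {j} i∈B j∉B = subset-ext λ k → trans (lookup-swapS i j B k) (pointwise k)
    where
    pointwise : ∀ k → lookup B (PC.transpose i j k) ≡ lookup ((B -ₛ i) +ₛ j) k
    pointwise k with which i j k
    ... | first = trans (cong (lookup B) (transpose-matchˡ k j))
                    (trans j∉B (sym (trans (lookup-+ₛ (B -ₛ k) k≢j) (lookup--ₛ-same B k))))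
      where
      k≢j : k ≢ j
      k≢j refl = not-¬ i∈B j∉B
    ... | second = trans (cong (lookup B) (transpose-matchʳ i k))
                     (trans i∈B (sym (lookup-+ₛ-same (B -ₛ i) k)))
    ... | other k≢i k≢j = trans (cong (lookup B) (transpose-other k≢i k≢j))
                            (sym (trans (lookup-+ₛ (B -ₛ i) k≢j) (lookup--ₛ B k≢i)))

  swapS-added : ∀ {D : Subset n} {x v} → lookup D x ≡ false → lookup D v ≡ false → v ≢ x →
                swapS x v (D +ₛ x) ≡ D +ₛ v
  swapS-added {D} {x} {v} x∉D v∉D v≢x =
    trans (swapS-exchange (lookup-+ₛ-same D x) (trans (lookup-+ₛ D v≢x) v∉D))
          (cong (_+ₛ v) (+ₛ--ₛ x∉D))

  almostBasis-U : ∀ {𝓒 : Family n} {D x} → T (U 𝓒 D x) → AlmostBasis 𝓒 D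
  almostBasis-U {D = D} {x} u =
    D +ₛ x , x , U⇒basis u , lookup⇒[]= x (D +ₛ x) (lookup-+ₛ-same D x) ,
    sym (+ₛ--ₛ (U⇒∉ u))

  almostBasis-extendable : ∀ {𝓒 : Family n} {D} → AlmostBasis 𝓒 D → ∃[ x ] T (U 𝓒 D x)
  almostBasis-extendable {𝓒} (B , x , b , x∈B , refl) =
    x , U-intro (lookup--ₛ-same B x) (subst (T ∘ 𝓒) (sym (-ₛ-+ₛ ([]=⇒lookup x∈B))) b)

  lookup⇒∉ : ∀ {Y : Subset n} {y} → lookup Y y ≡ false → y ∉ Y
  lookup⇒∉ y∉Y y∈Y = not-¬ ([]=⇒lookup y∈Y) y∉Y

  ∉⇒lookup : ∀ {Y : Subset n} {y} → y ∉ Y → lookup Y y ≡ false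
  ∉⇒lookup {Y} {y} y∉Y with lookup Y y in eq
  ... | true  = ⊥-elim (y∉Y (lookup⇒[]= y Y eq))
  ... | false = refl

  exchange : ∀ {𝓑 : Family n} → IsMatroid 𝓑 → ∀ {B₁ B₂} → T (𝓑 B₁) → T (𝓑 B₂) →
             ∀ {x} → lookup B₁ x ≡ true → lookup B₂ x ≡ false →
             ∃[ y ] lookup B₂ y ≡ true × lookup B₁ y ≡ false × T (𝓑 ((B₁ -ₛ x) +ₛ y))
  exchange (_ , exch) {B₁} {B₂} b₁ b₂ {x} x∈B₁ x∉B₂
    with exch B₁ B₂ b₁ b₂ x (lookup⇒[]= x B₁ x∈B₁) (lookup⇒∉ x∉B₂)
  ... | y , y∈B₂ , y∉B₁ , b = y , []=⇒lookup y∈B₂ , ∉⇒lookup y∉B₁ , b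

  -- Least elements and the map φ

  rank-injective : ∀ (ρ : LinOrder {n}) {x y} → rank ρ x ≡ rank ρ y → x ≡ y
  rank-injective ρ {x} {y} eq =
    trans (sym (inverseˡ ρ)) (trans (cong (ρ ⟨$⟩ˡ_) (toℕ-injective eq)) (inverseˡ ρ))

  record IsMin (ρ : LinOrder {n}) (S : Fin n → Bool) (x : Fin n) : Set where
    field
      holds : T (S x)
      least : ∀ {y} → T (S y) → rank ρ x ≤ rank ρ y
  open IsMin public

  IsMin-unique : ∀ {ρ S x y} → IsMin ρ S x → IsMin ρ S y → x ≡ y
  IsMin-unique {ρ} mx my = rank-injective ρ (≤-antisym (least mx (holds my)) (least my (holds mx)))

  first-match : ∀ {m} (S : Fin n → Bool) (f : Fin m → Fin n) {y} →
                findᵇ S (List.tabulate f) ≡ just y →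
                ∃[ k ] f k ≡ y × T (S y) × (∀ j → T (S (f j)) → toℕ k ≤ toℕ j)
  first-match {suc m} S f found with S (f Fin.zero) in S[f0]
  ... | true  = Fin.zero , f0≡y , subst (T ∘ S) f0≡y (subst T (sym S[f0]) _) , λ _ _ → z≤n
    where f0≡y = just-injective found
  ... | false with first-match S (f ∘ Fin.suc) found
  ...   | k , fk≡y , Sy , earliest = Fin.suc k , fk≡y , Sy , earlier
    where
    earlier : ∀ j → T (S (f j)) → toℕ (Fin.suc k) ≤ toℕ j
    earlier Fin.zero    S[f0]′ = ⊥-elim (subst T S[f0] S[f0]′)
    earlier (Fin.suc j) S[fj]  = s≤s (earliest j S[fj])

  no-match : ∀ {m} (S : Fin n → Bool) (f : Fin m → Fin n) →
             findᵇ S (List.tabulate f) ≡ nothing → ∀ j → ¬ T (S (f j))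
  no-match {suc m} S f none j with S (f Fin.zero) in S[f0]
  no-match {suc m} S f () j | true
  no-match {suc m} S f none Fin.zero    | false = subst T S[f0]
  no-match {suc m} S f none (Fin.suc j) | false = no-match S (f ∘ Fin.suc) none j

  ordered-tabulate : ∀ (ρ : LinOrder {n}) → ordered ρ ≡ List.tabulate (ρ ⟨$⟩ˡ_)
  ordered-tabulate ρ = map-tabulate id (ρ ⟨$⟩ˡ_)

  minBy-just : ∀ ρ S {y} → minBy ρ S ≡ just y → IsMin ρ S y
  minBy-just ρ S found rewrite ordered-tabulate ρ with first-match S (ρ ⟨$⟩ˡ_) found
  ... | k , refl , Sy , earliest = record { holds = Sy ; least = below }
    where
    below : ∀ {y} → T (S y) → rank ρ (ρ ⟨$⟩ˡ k) ≤ rank ρ y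
    below {y} Sy′ = subst₂ _≤_ (cong toℕ (sym (inverseʳ ρ))) refl
                      (earliest (ρ ⟨$⟩ʳ y) (subst (T ∘ S) (sym (inverseˡ ρ)) Sy′))

  minBy-nothing : ∀ ρ S → minBy ρ S ≡ nothing → ∀ y → ¬ T (S y)
  minBy-nothing ρ S none y rewrite ordered-tabulate ρ =
    no-match S (ρ ⟨$⟩ˡ_) none (ρ ⟨$⟩ʳ y) ∘ subst (T ∘ S) (sym (inverseˡ ρ))

  min-exists : ∀ ρ S {u} → T (S u) → ∃[ x ] IsMin ρ S x
  min-exists ρ S Su with minBy ρ S in found
  ... | just x  = x , minBy-just ρ S found
  ... | nothing = ⊥-elim (minBy-nothing ρ S found _ Su)

  φ-just : ∀ (𝓒 : Family n) ρ {D B} → φ 𝓒 ρ D ≡ just B → ∃[ x ] IsMin ρ (U 𝓒 D) x × B ≡ D +ₛ x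
  φ-just 𝓒 ρ {D} eq with minBy ρ (U 𝓒 D) in found
  φ-just 𝓒 ρ {D} refl | just x = x , minBy-just ρ (U 𝓒 D) found , refl

  φ-intro : ∀ (𝓒 : Family n) ρ {D x} → IsMin ρ (U 𝓒 D) x → φ 𝓒 ρ D ≡ just (D +ₛ x)
  φ-intro 𝓒 ρ {D} m with minBy ρ (U 𝓒 D) in found
  ... | just x′ = cong (just ∘ (D +ₛ_)) (IsMin-unique (minBy-just ρ (U 𝓒 D) found) m)
  ... | nothing = ⊥-elim (minBy-nothing ρ (U 𝓒 D) found _ (holds m))

  almostBasis-φ : ∀ (𝓒 : Family n) ρ {D B} → φ 𝓒 ρ D ≡ just B → AlmostBasis 𝓒 D
  almostBasis-φ 𝓒 ρ φD with φ-just 𝓒 ρ φD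
  ... | _ , m , _ = almostBasis-U (holds m)

-- Linkings

module _ {n : ℕ} {𝓑 𝓑* : Family n} (L : Linking 𝓑 𝓑*) where
  open Linking L

  star-basis : ∀ B (b : T (𝓑 B)) → T (𝓑* (star B b))
  star-basis B b = proj₂ (Bijection.to bij (B , b))

  star-cong : ∀ {B B'} → B ≡ B' → ∀ (b : T (𝓑 B)) b' → star B b ≡ star B' b'
  star-cong refl b b' = cong (star _) (T-irrelevant b b')

  star-injective : ∀ {B B'} (b : T (𝓑 B)) b' → star B b ≡ star B' b' → B ≡ B'
  star-injective b b' eq = cong proj₁ (Bijection.injective bij (bases-≡ eq))
    where
    bases-≡ : ∀ {u v : Bases 𝓑*} → proj₁ u ≡ proj₁ v → u ≡ v
    bases-≡ {_ , p} {_ , q} refl = cong (_ ,_) (T-irrelevant p q)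

  swap-fixes-star⇒swap-fixes : ∀ {B} (b : T (𝓑 B)) {i j} → i ≢ j → T (𝓑 (swapS i j B)) →
    lookup (star B b) i ≡ lookup (star B b) j → lookup B i ≡ lookup B j
  swap-fixes-star⇒swap-fixes {B} b {i} {j} i≢j tb fixes* =
    swapS-fixed⁻¹ (star-injective tb b (trans (sym (proj₂ (L1 B b i j i≢j tb))) (swapS-fixed fixes*)))

  swap-fixes⇒swap-fixes-star : ∀ {B} (b : T (𝓑 B)) {i j} → i ≢ j → T (𝓑* (swapS i j (star B b))) →
    lookup B i ≡ lookup B j → lookup (star B b) i ≡ lookup (star B b) j
  swap-fixes⇒swap-fixes-star {B} b {i} {j} i≢j tb* fixes with L2 B b i j i≢j tb*
  ... | tb , eq = swapS-fixed⁻¹ (trans eq (star-cong (swapS-fixed fixes) tb b))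

id-linking : ∀ {n} {𝓑 : Family n} → Linking 𝓑 𝓑
id-linking = record
  { bij = ⤖-id _
  ; L1  = λ _ _ _ _ _ tb → tb , refl
  ; L2  = λ _ _ _ _ _ tb → tb , refl
  }

-- The transposition of a and z

module Transposition {n : ℕ} (a z : Fin n) (a≢z : a ≢ z) where

  ε : Fin n → Fin n
  ε = PC.transpose a z

  εS : Subset n → Subset n
  εS = swapS a z

  ε-involutive : ∀ k → ε (ε k) ≡ k
  ε-involutive = transpose-involutive a z

  data Pair : Fin n → Fin n → Set where
    az : Pair a z
    za : Pair z a

  pair-sym : ∀ {c c'} → Pair c c' → Pair c' c
  pair-sym az = za
  pair-sym za = az

  pair-≢ : ∀ {c c'} → Pair c c' → c ≢ c'
  pair-≢ az = a≢z
  pair-≢ za = a≢z ∘ sym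

  pair-cases : ∀ {c c' d d'} → Pair c c' → Pair d d' → (c ≡ d × c' ≡ d') ⊎ (c ≡ d' × c' ≡ d)
  pair-cases az az = inj₁ (refl , refl)
  pair-cases az za = inj₂ (refl , refl)
  pair-cases za az = inj₂ (refl , refl)
  pair-cases za za = inj₁ (refl , refl)

  ε-first : ∀ {c c'} → Pair c c' → ε c ≡ c'
  ε-first az = transpose-matchˡ a z
  ε-first za = transpose-matchʳ a z

  ε-second : ∀ {c c'} → Pair c c' → ε c' ≡ c
  ε-second = ε-first ∘ pair-sym

  ε-other : ∀ {c c' k} → Pair c c' → k ≢ c → k ≢ c' → ε k ≡ k
  ε-other az k≢a k≢z = transpose-other k≢a k≢z
  ε-other za k≢z k≢a = transpose-other k≢a k≢z

  εS-fixed : ∀ {c c' Y} → Pair c c' → lookup Y c ≡ lookup Y c' → εS Y ≡ Y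
  εS-fixed az eq = swapS-fixed eq
  εS-fixed za eq = swapS-fixed (sym eq)

  εS-pair : ∀ {c c'} → Pair c c' → ∀ Y → εS Y ≡ swapS c c' Y
  εS-pair az Y = refl
  εS-pair za Y = swapS-comm a z Y

  U-twisted : ∀ (𝓑 : Family n) D y → U 𝓑 (εS D) (ε y) ≡ U (𝓑 ∘ εS) D y
  U-twisted 𝓑 D y =
    cong₂ (λ b Y → not b ∧ 𝓑 Y)
      (trans (lookup-swapS a z D (ε y)) (cong (lookup D) (ε-involutive y)))
      (sym (swapS-+ₛ a z D y))

  φ-twisted : ∀ (𝓑 : Family n) (ρ σ : LinOrder {n}) → (∀ y → rank σ y ≡ rank ρ (ε y)) →
              ∀ {D x} → IsMin ρ (U (𝓑 ∘ εS) D) x → φ 𝓑 σ (εS D) ≡ just (εS (D +ₛ x))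
  φ-twisted 𝓑 ρ σ rank-σ {D} {x} m =
    trans (φ-intro 𝓑 σ record { holds = subst T (sym (U-twisted 𝓑 D x)) (holds m) ; least = below })
          (cong just (sym (swapS-+ₛ a z D x)))
    where
    below : ∀ {y} → T (U 𝓑 (εS D) y) → rank σ (ε x) ≤ rank σ y
    below {y} uy = subst₂ _≤_ (trans (cong (rank ρ) (sym (ε-involutive x))) (sym (rank-σ (ε x))))
                              (sym (rank-σ y))
                     (least m (subst T (U-twisted 𝓑 D (ε y))
                                 (subst (T ∘ U 𝓑 (εS D)) (sym (ε-involutive y)) uy)))

  module Consecutive (ρ : LinOrder {n}) {p q} (pq : Pair p q)
                     (consecutive : rank ρ q ≡ suc (rank ρ p)) where

    rank-≤∧≢⇒< : ∀ {u v} → rank ρ u ≤ rank ρ v → u ≢ v → rank ρ u < rank ρ v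
    rank-≤∧≢⇒< u≤v u≢v = ≤∧≢⇒< u≤v (u≢v ∘ rank-injective ρ)

    ≤-below-q : ∀ {u} → rank ρ u ≤ rank ρ q → u ≢ q → rank ρ u ≤ rank ρ p
    ≤-below-q u≤q u≢q = ≤-pred (subst (_ <_) consecutive (rank-≤∧≢⇒< u≤q u≢q))

    ≤-via-ε : ∀ {u v u′ v′} → ε u ≡ u′ → ε v ≡ v′ → rank ρ u′ ≤ rank ρ v′ → rank ρ (ε u) ≤ rank ρ (ε v)
    ≤-via-ε refl refl le = le

    p≤q : rank ρ p ≤ rank ρ q
    p≤q = subst (_ ≤_) (sym consecutive) (n≤1+n _)

    below-pair : ∀ {c c' y} → Pair c c' → y ≢ c → y ≢ c' → rank ρ y ≤ rank ρ c' → rank ρ y < rank ρ p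
    below-pair cc' y≢c y≢c' y≤c' with pair-cases cc' pq
    ... | inj₁ (refl , refl) = rank-≤∧≢⇒< (≤-below-q y≤c' y≢c') y≢c
    ... | inj₂ (refl , refl) = rank-≤∧≢⇒< y≤c' y≢c'

    ε-monotone : ∀ {u v} → u ≢ p → rank ρ u ≤ rank ρ v → rank ρ (ε u) ≤ rank ρ (ε v)
    ε-monotone {u} {v} u≢p u≤v with which p q u | which p q v
    ... | first  | _      = ⊥-elim (u≢p refl)
    ... | second | first  = ⊥-elim (<⇒≱ (subst (_ <_) (sym consecutive) (n<1+n _)) u≤v)
    ... | second | second = ≤-refl
    ... | second | other v≢p v≢q = ≤-via-ε {u} {v} (ε-second pq) (ε-other pq v≢p v≢q) (≤-trans p≤q u≤v)
    ... | other u≢p u≢q | first  = ≤-via-ε {u} {v} (ε-other pq u≢p u≢q) (ε-first pq) (≤-trans u≤v p≤q)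
    ... | other u≢p u≢q | second = ≤-via-ε {u} {v} (ε-other pq u≢p u≢q) (ε-second pq) (≤-below-q u≤v u≢q)
    ... | other u≢p u≢q | other v≢p v≢q = ≤-via-ε {u} {v} (ε-other pq u≢p u≢q) (ε-other pq v≢p v≢q) u≤v

    IsMin-transposed : ∀ (σ : LinOrder {n}) → (∀ y → rank σ y ≡ rank ρ (ε y)) →
                       ∀ {S m} → IsMin ρ S m → m ≢ p → IsMin σ S m
    IsMin-transposed σ rank-σ m-min m≢p = record
      { holds = holds m-min
      ; least = λ Sy → subst₂ _≤_ (sym (rank-σ _)) (sym (rank-σ _)) (ε-monotone m≢p (least m-min Sy))
      }

  -- `square` excludes exactly the configuration that the exchanges in
  -- `Transfer.OffPair.SmallerOutside` produce.
  record Good (𝓑 : Family n) (Low : Fin n → Set) (B : Subset n) : Set where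
    field
      swap-basis : T (𝓑 (εS B))
      c c'       : Fin n
      pair       : Pair c c'
      c∈B        : lookup B c ≡ true
      c'∉B       : lookup B c' ≡ false
      square     : ∀ {w x} → lookup B w ≡ false → lookup B x ≡ true → Low w → Low x →
                   T (𝓑 (swapS c w B)) → T (𝓑 (swapS x c' B)) → T (𝓑 (swapS x w B))

  twisted-minimum-at-pair : ∀ {𝓑 : Family n} {ρ D c c'} → Pair c c' → lookup D c' ≡ false →
                            T (𝓑 (εS (D +ₛ c))) → IsMin ρ (U 𝓑 D) c → IsMin ρ (U (𝓑 ∘ εS) D) c
  twisted-minimum-at-pair {𝓑} {ρ} {D} {c} {c'} cc' c'∉D εB m =
    record { holds = U-intro c∉D εB ; least = below }
    where
    c∉D : lookup D c ≡ false
    c∉D = U⇒∉ (holds m)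

    εS-+ₛ : ∀ y → εS (D +ₛ y) ≡ D +ₛ ε y
    εS-+ₛ y = trans (swapS-+ₛ a z D y) (cong (_+ₛ ε y) (εS-fixed cc' (trans c∉D (sym c'∉D))))

    below : ∀ {y} → T (U (𝓑 ∘ εS) D y) → rank ρ c ≤ rank ρ y
    below {y} uy with which c c' y
    ... | first  = ≤-refl
    ... | second = least m (U-intro c'∉D
            (subst (T ∘ 𝓑) (trans (εS-+ₛ c) (cong (D +ₛ_) (ε-first cc'))) εB))
    ... | other y≢c y≢c' = least m (U-intro (U⇒∉ uy)
            (subst (T ∘ 𝓑) (trans (εS-+ₛ y) (cong (D +ₛ_) (ε-other cc' y≢c y≢c'))) (U⇒basis uy)))

  -- ρ is ω (with p = a) or π (with p = z), while Low is the same set in both cases.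
  module Transfer (𝓑 : Family n) (M : IsMatroid 𝓑) (Low : Fin n → Set)
                  (ρ : LinOrder {n}) {p q} (pq : Pair p q) (consecutive : rank ρ q ≡ suc (rank ρ p))
                  (low : ∀ {y} → rank ρ y < rank ρ p → Low y) where

    open Consecutive ρ pq consecutive

    module OffPair {D x} (G : Good 𝓑 Low (D +ₛ x)) (m : IsMin ρ (U 𝓑 D) x) (x≢c : x ≢ Good.c G) where
      open Good G

      x∉D : lookup D x ≡ false
      x∉D = U⇒∉ (holds m)

      B : Subset n
      B = D +ₛ x

      B-basis : T (𝓑 B)
      B-basis = U⇒basis (holds m)

      x∈B : lookup B x ≡ true
      x∈B = lookup-+ₛ-same D x

      c∈D : lookup D c ≡ true
      c∈D = trans (sym (lookup-+ₛ D (x≢c ∘ sym))) c∈B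

      c'∉D : lookup D c' ≡ false
      c'∉D = ∉-+ₛ D x c'∉B

      x≢c' : x ≢ c'
      x≢c' refl = not-¬ x∈B c'∉B

      extension-above : ∀ {v} → lookup D v ≡ false → T (𝓑 (D +ₛ v)) → rank ρ x ≤ rank ρ v
      extension-above v∉D b = least m (U-intro v∉D b)

      module SmallerOutside {w} (w∉D : lookup D w ≡ false) (w≢c : w ≢ c) (w≢c' : w ≢ c')
                            (εB′ : T (𝓑 (εS (D +ₛ w)))) (w<x : rank ρ w < rank ρ x) where

        -- B′ = D - c + c' + w
        B′ : Subset n
        B′ = εS (D +ₛ w)

        w≢x : w ≢ x
        w≢x refl = <-irrefl refl w<x

        D+w∉𝓑 : ¬ T (𝓑 (D +ₛ w))
        D+w∉𝓑 b = <⇒≱ w<x (extension-above w∉D b)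

        lookup-B′ : ∀ k → lookup B′ k ≡ lookup (D +ₛ w) (ε k)
        lookup-B′ = lookup-swapS a z (D +ₛ w)

        lookup-B′-other : ∀ {v} → v ≢ c → v ≢ c' → lookup B′ v ≡ lookup (D +ₛ w) v
        lookup-B′-other {v} v≢c v≢c' =
          trans (lookup-B′ v) (cong (lookup (D +ₛ w)) (ε-other pair v≢c v≢c'))

        x∉B′ : lookup B′ x ≡ false
        x∉B′ = trans (lookup-B′-other x≢c x≢c') (trans (lookup-+ₛ D (w≢x ∘ sym)) x∉D)

        c∉B′ : lookup B′ c ≡ false
        c∉B′ = trans (lookup-B′ c) (trans (cong (lookup (D +ₛ w)) (ε-first pair))
                                          (trans (lookup-+ₛ D (w≢c' ∘ sym)) c'∉D))

        c'∈B′ : lookup B′ c' ≡ true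
        c'∈B′ = trans (lookup-B′ c') (trans (cong (lookup (D +ₛ w)) (ε-second pair)) (+ₛ-mono D w c∈D))

        B′∖B : ∀ {v} → lookup B′ v ≡ true → lookup B v ≡ false → v ≡ c' ⊎ v ≡ w
        B′∖B {v} v∈B′ v∉B with which c c' v
        ... | first  = ⊥-elim (not-¬ c∈B v∉B)
        ... | second = inj₁ refl
        ... | other v≢c v≢c' with v ≟ w
        ...   | yes v≡w = inj₂ v≡w
        ...   | no v≢w  = ⊥-elim (not-¬ v∈D (∉-+ₛ D x v∉B))
          where
          v∈D : lookup D v ≡ true
          v∈D = trans (sym (lookup-+ₛ D v≢w)) (trans (sym (lookup-B′-other v≢c v≢c')) v∈B′)

        D∖B′ : ∀ {v} → lookup D v ≡ true → lookup B′ v ≡ false → v ≡ c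
        D∖B′ {v} v∈D v∉B′ with which c c' v
        ... | first  = refl
        ... | second = ⊥-elim (not-¬ v∈D c'∉D)
        ... | other v≢c v≢c' =
          ⊥-elim (not-¬ (+ₛ-mono D w v∈D) (trans (sym (lookup-B′-other v≢c v≢c')) v∉B′))

        B∖B′ : ∀ {v} → lookup B v ≡ true → lookup B′ v ≡ false → v ≡ x ⊎ v ≡ c
        B∖B′ {v} v∈B v∉B′ with v ≟ x
        ... | yes v≡x = inj₁ v≡x
        ... | no v≢x  = inj₂ (D∖B′ (trans (sym (lookup-+ₛ D v≢x)) v∈B) v∉B′)

        w∉B : lookup B w ≡ false
        w∉B = trans (lookup-+ₛ D w≢x) w∉D

        B′-c'+c : (B′ -ₛ c') +ₛ c ≡ D +ₛ w
        B′-c'+c = begin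
          (B′ -ₛ c') +ₛ c                  ≡⟨ swapS-exchange c'∈B′ c∉B′ ⟨
          swapS c' c B′                    ≡⟨ swapS-comm c' c B′ ⟩
          swapS c c' B′                    ≡⟨ cong (swapS c c') (εS-pair pair (D +ₛ w)) ⟩
          swapS c c' (swapS c c' (D +ₛ w)) ≡⟨ swapS-involutive c c' (D +ₛ w) ⟩
          D +ₛ w                           ∎

        B′-c'+x : (B′ -ₛ c') +ₛ x ≡ swapS c w B
        B′-c'+x = begin
          (B′ -ₛ c') +ₛ x              ≡⟨ cong (_+ₛ x) B′-c' ⟩
          ((D +ₛ w) -ₛ c) +ₛ x         ≡⟨ []≔-commutes (D +ₛ w) c x (x≢c ∘ sym) ⟩
          ((D +ₛ w) +ₛ x) -ₛ c         ≡⟨ cong (_-ₛ c) ([]≔-commutes D w x w≢x) ⟩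
          ((D +ₛ x) +ₛ w) -ₛ c         ≡⟨ []≔-commutes B c w (w≢c ∘ sym) ⟨
          (B -ₛ c) +ₛ w                ≡⟨ swapS-exchange c∈B w∉B ⟨
          swapS c w B                  ∎
          where
          B′-c' : B′ -ₛ c' ≡ (D +ₛ w) -ₛ c
          B′-c' = begin
            B′ -ₛ c'                   ≡⟨ +ₛ--ₛ (trans (lookup--ₛ B′ (pair-≢ pair)) c∉B′) ⟨
            ((B′ -ₛ c') +ₛ c) -ₛ c     ≡⟨ cong (_-ₛ c) B′-c'+c ⟩
            (D +ₛ w) -ₛ c              ∎

        D+c'-basis : T (𝓑 (D +ₛ c'))
        D+c'-basis with exchange M B-basis εB′ x∈B x∉B′
        ... | v , v∈B′ , v∉B , b with B′∖B v∈B′ v∉B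
        ...   | inj₁ refl = subst (λ Y → T (𝓑 (Y +ₛ c'))) (+ₛ--ₛ x∉D) b
        ...   | inj₂ refl = ⊥-elim (D+w∉𝓑 (subst (λ Y → T (𝓑 (Y +ₛ w))) (+ₛ--ₛ x∉D) b))

        x<p : rank ρ x < rank ρ p
        x<p = below-pair pair x≢c x≢c' (extension-above c'∉D D+c'-basis)

        swap-c-w-basis : T (𝓑 (swapS c w B))
        swap-c-w-basis with exchange M εB′ B-basis c'∈B′ c'∉B
        ... | v , v∈B , v∉B′ , b with B∖B′ v∈B v∉B′
        ...   | inj₁ refl = subst (T ∘ 𝓑) B′-c'+x b
        ...   | inj₂ refl = ⊥-elim (D+w∉𝓑 (subst (T ∘ 𝓑) B′-c'+c b))

        impossible : ⊥
        impossible = D+w∉𝓑 (subst (T ∘ 𝓑) (swapS-added x∉D w∉D w≢x)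
          (square w∉B x∈B (low (<-trans w<x x<p)) (low x<p) swap-c-w-basis
                  (subst (T ∘ 𝓑) (sym (swapS-added x∉D c'∉D (x≢c' ∘ sym))) D+c'-basis)))

      no-smaller-twisted : ∀ {w} → lookup D w ≡ false → T (𝓑 (εS (D +ₛ w))) → ¬ (rank ρ w < rank ρ x)
      no-smaller-twisted {w} w∉D εB′ w<x with which c c' w
      ... | first  = not-¬ c∈D w∉D
      ... | second = <⇒≱ w<x (extension-above c'∉D (subst (T ∘ 𝓑) (εS-fixed pair both) εB′))
        where
        both : lookup (D +ₛ c') c ≡ lookup (D +ₛ c') c'
        both = trans (+ₛ-mono D c' c∈D) (sym (lookup-+ₛ-same D c'))
      ... | other w≢c w≢c' = SmallerOutside.impossible w∉D w≢c w≢c' εB′ w<x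

      twisted-minimum-off-pair : IsMin ρ (U (𝓑 ∘ εS) D) x
      twisted-minimum-off-pair = record
        { holds = U-intro x∉D swap-basis
        ; least = λ uy → ≮⇒≥ (no-smaller-twisted (U⇒∉ uy) (U⇒basis uy))
        }

    twisted-minimum : ∀ {D x} → Good 𝓑 Low (D +ₛ x) → IsMin ρ (U 𝓑 D) x → IsMin ρ (U (𝓑 ∘ εS) D) x
    twisted-minimum {D} {x} G m with x ≟ Good.c G
    ... | yes refl =
      twisted-minimum-at-pair {𝓑} {ρ} {D} (Good.pair G) (∉-+ₛ D x (Good.c'∉B G)) (Good.swap-basis G) m
    ... | no x≢c   = OffPair.twisted-minimum-off-pair G m x≢c

    transfer : ∀ (σ : LinOrder {n}) → (∀ y → rank σ y ≡ rank ρ (ε y)) →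
               ∀ {B D} → Good 𝓑 Low B → φ 𝓑 ρ D ≡ just B →
               AlmostBasis 𝓑 (εS D) × φ 𝓑 σ (εS D) ≡ just (εS B)
    transfer σ rank-σ {D = D} G φD with φ-just 𝓑 ρ φD
    ... | x , m , refl = almostBasis-φ 𝓑 σ φσ , φσ
      where
      φσ : φ 𝓑 σ (εS D) ≡ just (εS (D +ₛ x))
      φσ = φ-twisted 𝓑 ρ σ rank-σ {D} (twisted-minimum G m)

  pair-separates : ∀ {c c' Y} → Pair c c' → lookup Y c ≡ true → lookup Y c' ≡ false →
                   lookup Y a ≢ lookup Y z
  pair-separates az c∈Y c'∉Y eq = not-¬ (trans (sym eq) c∈Y) c'∉Y
  pair-separates za c∈Y c'∉Y eq = not-¬ (trans eq c∈Y) c'∉Y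

  split-pair : ∀ {Y} → lookup Y a ≢ lookup Y z →
               ∃[ c ] ∃[ c' ] Pair c c' × lookup Y c ≡ true × lookup Y c' ≡ false
  split-pair {Y} a≢z-in-Y with lookup Y a in ea | lookup Y z in ez
  ... | true  | false = a , z , az , ea , ez
  ... | false | true  = z , a , za , ez , ea
  ... | true  | true  = ⊥-elim (a≢z-in-Y refl)
  ... | false | false = ⊥-elim (a≢z-in-Y refl)

  record Fork (𝓒 : Family n) (Low : Fin n → Set) (A : Subset n) : Set where
    field
      a-extends        : T (U 𝓒 A a)
      z-extends        : T (U 𝓒 A z)
      no-low-extension : ∀ {y} → T (U 𝓒 A y) → ¬ Low y

    extends : ∀ {c c'} → Pair c c' → T (U 𝓒 A c)
    extends az = a-extends
    extends za = z-extends

  module FromFork {𝓑 𝓒 : Family n} (L : Linking 𝓑 𝓒) {Low A} (F : Fork 𝓒 Low A)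
                  {c₀ c₁} (P : Pair c₀ c₁) {B} (b : T (𝓑 B)) (B*≡ : Linking.star L B b ≡ A +ₛ c₀) where
    open Linking L
    open Fork F

    B* : Subset n
    B* = star B b

    c₀∉A : lookup A c₀ ≡ false
    c₀∉A = U⇒∉ (extends P)

    c₁∉A : lookup A c₁ ≡ false
    c₁∉A = U⇒∉ (extends (pair-sym P))

    lookup-B* : ∀ k → lookup B* k ≡ lookup (A +ₛ c₀) k
    lookup-B* k = cong (λ Y → lookup Y k) B*≡

    c₀∈B* : lookup B* c₀ ≡ true
    c₀∈B* = trans (lookup-B* c₀) (lookup-+ₛ-same A c₀)

    c₁∉B* : lookup B* c₁ ≡ false
    c₁∉B* = trans (lookup-B* c₁) (trans (lookup-+ₛ A (pair-≢ P ∘ sym)) c₁∉A)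

    ∉B*⇒∉A : ∀ {k} → lookup B* k ≡ false → lookup A k ≡ false
    ∉B*⇒∉A k∉B* = ∉-+ₛ A c₀ (trans (sym (lookup-B* _)) k∉B*)

    εB* : εS B* ≡ A +ₛ c₁
    εB* = begin
      εS B*               ≡⟨ cong εS B*≡ ⟩
      εS (A +ₛ c₀)        ≡⟨ swapS-+ₛ a z A c₀ ⟩
      εS A +ₛ ε c₀        ≡⟨ cong₂ _+ₛ_ (εS-fixed P (trans c₀∉A (sym c₁∉A))) (ε-first P) ⟩
      A +ₛ c₁             ∎

    εB*-basis : T (𝓒 (εS B*))
    εB*-basis = subst (T ∘ 𝓒) (sym εB*) (U⇒basis (extends (pair-sym P)))

    swapped-link : Σ (T (𝓑 (εS B))) λ tb → star (εS B) tb ≡ A +ₛ c₁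
    swapped-link with L2 B b a z a≢z εB*-basis
    ... | tb , eq = tb , trans (sym eq) εB*

    low-extension-impossible : ∀ {k} → lookup B* k ≡ false → T (𝓒 (A +ₛ k)) → ¬ Low k
    low-extension-impossible k∉B* bk = no-low-extension (U-intro (∉B*⇒∉A k∉B*) bk)

    module Square {c c' w x} (cc' : Pair c c') (c∈B : lookup B c ≡ true) (c'∉B : lookup B c' ≡ false)
                  (w∉B : lookup B w ≡ false) (x∈B : lookup B x ≡ true) (low-w : Low w) (low-x : Low x)
                  (bcw : T (𝓑 (swapS c w B))) (bxc' : T (𝓑 (swapS x c' B))) where

      c≢w : c ≢ w
      c≢w refl = not-¬ c∈B w∉B

      x≢w : x ≢ w
      x≢w refl = not-¬ x∈B w∉B

      x≢c' : x ≢ c'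
      x≢c' refl = not-¬ x∈B c'∉B

      c-w-separated : lookup B* c ≢ lookup B* w
      c-w-separated fixes* = not-¬ (trans (sym (swap-fixes-star⇒swap-fixes L b c≢w bcw fixes*)) c∈B) w∉B

      completes : T (𝓑 (swapS x w B))
      completes with pair-cases cc' P | lookup B* w in w-B*
      ... | inj₁ (refl , refl) | true  = ⊥-elim (c-w-separated (trans c₀∈B* (sym w-B*)))
      ... | inj₂ (refl , refl) | false = ⊥-elim (c-w-separated (trans c₁∉B* (sym w-B*)))
      ... | inj₁ (refl , refl) | false = ⊥-elim (low-extension-impossible w-B* A+w-basis low-w)
        where
        A+w-basis : T (𝓒 (A +ₛ w))
        A+w-basis = subst (T ∘ 𝓒)
          (trans (cong (swapS c w) B*≡) (swapS-added c₀∉A (∉B*⇒∉A w-B*) (c≢w ∘ sym)))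
          (proj₁ (L1 B b c w c≢w bcw))
      ... | inj₂ (refl , refl) | true with lookup B* x in x-B*
      ...   | true  = proj₁ (L2 B b x w x≢w (subst (T ∘ 𝓒) (sym (swapS-fixed (trans x-B* (sym w-B*))))
                                                         (star-basis L B b)))
      ...   | false = ⊥-elim (low-extension-impossible x-B* A+x-basis low-x)
        where
        A+x-basis : T (𝓒 (A +ₛ x))
        A+x-basis = subst (T ∘ 𝓒)
          (trans (swapS-comm x c' B*) (trans (cong (swapS c' x) B*≡)
                 (swapS-added c₀∉A (∉B*⇒∉A x-B*) x≢c')))
          (proj₁ (L1 B b x c' x≢c' bxc'))

    a-z-separated : lookup B a ≢ lookup B z
    a-z-separated = pair-separates {Y = B*} P c₀∈B* c₁∉B* ∘ swap-fixes⇒swap-fixes-star L b a≢z εB*-basis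

    good : Good 𝓑 Low B
    good with split-pair {B} a-z-separated
    ... | c , c' , cc' , c∈B , c'∉B = record
      { swap-basis = proj₁ swapped-link
      ; c = c ; c' = c' ; pair = cc' ; c∈B = c∈B ; c'∉B = c'∉B
      ; square = Square.completes cc' c∈B c'∉B
      }

module Theorem {n : ℕ} (ω : LinOrder {n}) (a z : Fin n) (a≢z : a ≢ z)
               (consecutive : rank ω z ≡ suc (rank ω a)) where
  open Transposition a z a≢z public

  π : LinOrder {n}
  π = swapOrder ω a z

  Low : Fin n → Set
  Low y = rank ω y < rank ω a

  rank-π : ∀ y → rank π y ≡ rank ω (ε y)
  rank-π y = refl

  rank-ω : ∀ y → rank ω y ≡ rank π (ε y)
  rank-ω y = cong (rank ω) (sym (ε-involutive y))

  π-consecutive : rank π a ≡ suc (rank π z)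
  π-consecutive = begin
    rank ω (ε a)       ≡⟨ cong (rank ω) (ε-first az) ⟩
    rank ω z           ≡⟨ consecutive ⟩
    suc (rank ω a)     ≡⟨ cong (suc ∘ rank ω) (ε-second az) ⟨
    suc (rank ω (ε z)) ∎

  module Cω = Consecutive ω az consecutive
  module Cπ = Consecutive π za π-consecutive

  π-low : ∀ {y} → rank π y < rank π z → Low y
  π-low {y} y<z with which a z y
  ... | first  = ⊥-elim (<⇒≱ y<z Cπ.p≤q)
  ... | second = ⊥-elim (<-irrefl refl y<z)
  ... | other y≢a y≢z = subst₂ _<_ (cong (rank ω) (ε-other az y≢a y≢z)) (cong (rank ω) (ε-second az)) y<z

  branching-fork : ∀ {𝓒 A} → Branching 𝓒 ω π A →
                   Fork 𝓒 Low A × φ 𝓒 ω A ≡ just (A +ₛ a) × φ 𝓒 π A ≡ just (A +ₛ z)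
  branching-fork {𝓒} {A} (almost , φω≢φπ) with almostBasis-extendable almost
  ... | u , u-extends with min-exists ω (U 𝓒 A) u-extends | min-exists π (U 𝓒 A) u-extends
  ... | m , m-min | m' , m'-min with m ≟ a | m' ≟ z
  ... | no m≢a | _ = ⊥-elim (φω≢φπ (trans (φ-intro 𝓒 ω m-min)
                     (sym (φ-intro 𝓒 π (Cω.IsMin-transposed π rank-π m-min m≢a)))))
  ... | yes _ | no m'≢z = ⊥-elim (φω≢φπ (trans (φ-intro 𝓒 ω (Cπ.IsMin-transposed ω rank-ω m'-min m'≢z))
                     (sym (φ-intro 𝓒 π m'-min))))
  ... | yes refl | yes refl = fork , φ-intro 𝓒 ω m-min , φ-intro 𝓒 π m'-min
    where
    fork : Fork 𝓒 Low A
    fork = record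
      { a-extends = holds m-min
      ; z-extends = holds m'-min
      ; no-low-extension = λ uy y<a → <⇒≱ y<a (least m-min uy)
      }

  module _ {𝓑 𝓒 : Family n} (L : Linking 𝓑 𝓒) {B} (b : T (𝓑 B)) where

    fork-image-good : ∀ {A c c'} → Fork 𝓒 Low A → Pair c c' → Linking.star L B b ≡ A +ₛ c →
                   Good 𝓑 Low B × Good 𝓑 Low (εS B)
    fork-image-good F P B*≡ with FromFork.swapped-link L F P b B*≡
    ... | tb , εB*≡ = FromFork.good L F P b B*≡ , FromFork.good L F (pair-sym P) tb εB*≡

    branching-image-good : BranchingImage 𝓒 ω π (Linking.star L B b) → Good 𝓑 Low B × Good 𝓑 Low (εS B)
    branching-image-good (A , branching , image) with branching-fork branching | image
    ... | F , φω , _ | inj₁ φω≡ = fork-image-good F az (just-injective (trans (sym φω≡) φω))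
    ... | F , _ , φπ | inj₂ φπ≡ = fork-image-good F za (just-injective (trans (sym φπ≡) φπ))

  module _ {𝓑 : Family n} (M : IsMatroid 𝓑) {B} (goods : Good 𝓑 Low B × Good 𝓑 Low (εS B)) where

    forward : ∀ {D} → φ 𝓑 ω D ≡ just B → AlmostBasis 𝓑 (εS D) × φ 𝓑 π (εS D) ≡ just (εS B)
    forward = Transfer.transfer 𝓑 M Low ω az consecutive id π rank-π (proj₁ goods)

    backward : ∀ {D} → φ 𝓑 π D ≡ just (εS B) → AlmostBasis 𝓑 (εS D) × φ 𝓑 ω (εS D) ≡ just B
    backward φD = map₂ (λ φω → trans φω (cong just (swapS-involutive a z B)))
      (Transfer.transfer 𝓑 M Low π za π-consecutive π-low ω rank-ω (proj₂ goods) φD)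

lemma9p3 : (n : ℕ) (𝓑 𝓑* : Family n) → IsMatroid 𝓑 → IsMatroid 𝓑* →
    (L : Linking 𝓑 𝓑*) →
    (ω : LinOrder) (a z : Fin n) → a ≢ z → rank ω z ≡ suc (rank ω a) →
    (B : Subset n) (b : T (𝓑 B)) →
    (BranchingImage 𝓑 ω (swapOrder ω a z) B
      ⊎ BranchingImage 𝓑* ω (swapOrder ω a z) (Linking.star L B b)) →
    ((D : Subset n) → AlmostBasis 𝓑 D → φ 𝓑 ω D ≡ just B →
        AlmostBasis 𝓑 (swapS a z D) × φ 𝓑 (swapOrder ω a z) (swapS a z D) ≡ just (swapS a z B))
    × ((D : Subset n) → AlmostBasis 𝓑 D → φ 𝓑 (swapOrder ω a z) D ≡ just (swapS a z B) →
        AlmostBasis 𝓑 (swapS a z D) × φ 𝓑 ω (swapS a z D) ≡ just B)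
-- A branching image in 𝓑 itself is the case of the identity linking.
lemma9p3 n 𝓑 𝓑* M _ L ω a z a≢z consecutive B b image =
  (λ _ _ → forward M goods) , (λ _ _ → backward M goods)
  where
  open Theorem ω a z a≢z consecutive
  goods : Good 𝓑 Low B × Good 𝓑 Low (εS B)
  goods = [ branching-image-good id-linking b , branching-image-good L b ]′ image
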